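{- Let $$E=\begin{bmatrix} J_{k,a} & J_{k,b} & -J_{k,c} & -J_{k,d} & J_{k,e} & -J_{k,f} & 0 & 0 \\ -J_{k,a} & -J_{k,b} & J_{k,c} & J_{k,d} & -J_{k,e} & J_{k,f} & 0 & 0 \\ J_{l,a} & -J_{l,b} & J_{l,c} & -J_{l,d} & 0 & 0 & J_{l,g} & -J_{l,h} \\ -J_{l,a} & J_{l,b} & -J_{l,c} & J_{l,d} & 0 & 0 & -J_{l,g} & J_{l,h} \end{bmatrix}$$ where every column index of each block is a nonnegative integer, $k,l>0$, $a+b+c+d>0$, $e+f>0$, $g+h>0$, $E\mathbf{1}=0$ and $\mathbf{1}^TE=0^T$. Let $$A=\begin{bmatrix} 0 & 0 & J_{k,c} & J_{k,d} & 0 & J_{k,f} & X_{11} & X_{12} \\ J_{k,a} & J_{k,b} & 0 & 0 & J_{k,e} & 0 & X_{21} & X_{22} \\ 0 & J_{l,b} & 0 & J_{l,d} & Y_{11} & Y_{12} & 0 & J_{l,h} \\ J_{l,a} & 0 & J_{l,c} & 0 & Y_{21} & Y_{22} & J_{l,g} & 0 \end{bmatrix}$$ where each block of $A$ is a $(0,1)$ matrix. Then $A$ and $A+E$ are Gram mates if and only if: (i) $\mathbf{1}^TX_{1i}=\mathbf{1}^TX_{2i}$ and $\mathbf{1}^TY_{1i}=\mathbf{1}^TY_{2i}$ for $i=1,2$; and (ii) $\begin{bmatrix} X_{11} & X_{12}\\ X_{21} & X_{22}\end{bmatrix}\begin{bmatrix}\mathbf{1}\\-\mathbf{1}\end{bmatrix}=\frac{g-h}{2}\begin{bmatrix}\mathbf{1}\\\mathbf{1}\end{bmatrix}$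 and $\begin{bmatrix} Y_{11} & Y_{12}\\ Y_{21} & Y_{22}\end{bmatrix}\begin{bmatrix}\mathbf{1}\\-\mathbf{1}\end{bmatrix}=\frac{e-f}{2}\begin{bmatrix}\mathbf{1}\\\mathbf{1}\end{bmatrix}$, where $g-h$ and $e-f$ are even.
   Context: Two $(0,1)$ matrices $A$ and $B$ are Gram mates if $AA^T=BB^T$, $A^TA=B^TB$ and $A\neq B$. $J_{p,q}$ denotes the $p\times q$ all-ones matrix, $\mathbf{1}$ the all-ones column vector of appropriate size, and $0$ a zero matrix/vector of appropriate size. -}

module Defs where

open import Data.Nat as ℕ using (ℕ; zero; suc)
open import Data.Integer as ℤ using (ℤ; +_; 0ℤ; 1ℤ)
open import Data.Fin using (Fin; zero; suc; splitAt)
open import Data.Sum using (_⊎_; inj₁; inj₂)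
open import Data.Product using (_×_; Σ)
open import Relation.Binary.PropositionalEquality using (_≡_)
open import Relation.Nullary using (¬_)

Matrix : ℕ → ℕ → Set
Matrix m n = Fin m → Fin n → ℤ

∑ : ∀ {n} → (Fin n → ℤ) → ℤ
∑ {zero}  f = 0ℤ
∑ {suc n} f = f zero ℤ.+ ∑ (λ i → f (suc i))

_ᵀ : ∀ {m n} → Matrix m n → Matrix n m
(M ᵀ) i j = M j i

infixl 7 _⊗_
_⊗_ : ∀ {m n p} → Matrix m n → Matrix n p → Matrix m p
(M ⊗ N) i j = ∑ (λ r → M i r ℤ.* N r j)

infixl 6 _⊕_
_⊕_ : ∀ {m n} → Matrix m n → Matrix m n → Matrix m n
(M ⊕ N) i j = M i j ℤ.+ N i j

J : (p q : ℕ) → Matrix p q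
J p q _ _ = 1ℤ

-J : (p q : ℕ) → Matrix p q
-J p q _ _ = ℤ.- 1ℤ

O : (p q : ℕ) → Matrix p q
O p q _ _ = 0ℤ

𝟏 : (n : ℕ) → Matrix n 1
𝟏 n = J n 1

infixl 5 _‖_
_‖_ : ∀ {m n₁ n₂} → Matrix m n₁ → Matrix m n₂ → Matrix m (n₁ ℕ.+ n₂)
(_‖_ {n₁ = n₁} M N) i j with splitAt n₁ j
... | inj₁ j' = M i j'
... | inj₂ j' = N i j'

infixl 4 _⊟_
_⊟_ : ∀ {m₁ m₂ n} → Matrix m₁ n → Matrix m₂ n → Matrix (m₁ ℕ.+ m₂) n
(_⊟_ {m₁ = m₁} M N) i j with splitAt m₁ i
... | inj₁ i' = M i' j
... | inj₂ i' = N i' j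

infix 3 _≈_
_≈_ : ∀ {m n} → Matrix m n → Matrix m n → Set
M ≈ N = ∀ i j → M i j ≡ N i j

IsBinary : ∀ {m n} → Matrix m n → Set
IsBinary M = ∀ i j → (M i j ≡ 0ℤ) ⊎ (M i j ≡ 1ℤ)

GramMates : ∀ {m n} → Matrix m n → Matrix m n → Set
GramMates A B =
  IsBinary A × IsBinary B ×
  (A ⊗ (A ᵀ) ≈ B ⊗ (B ᵀ)) × ((A ᵀ) ⊗ A ≈ (B ᵀ) ⊗ B) × ¬ (A ≈ B)

Emat : (k l a b c d e f g h : ℕ) →
       Matrix (k ℕ.+ k ℕ.+ l ℕ.+ l) (a ℕ.+ b ℕ.+ c ℕ.+ d ℕ.+ e ℕ.+ f ℕ.+ g ℕ.+ h)
Emat k l a b c d e f g h =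
      (J k a ‖ J k b ‖ -J k c ‖ -J k d ‖ J k e ‖ -J k f ‖ O k g ‖ O k h)
   ⊟ (-J k a ‖ -J k b ‖ J k c ‖ J k d ‖ -J k e ‖ J k f ‖ O k g ‖ O k h)
   ⊟ (J l a ‖ -J l b ‖ J l c ‖ -J l d ‖ O l e ‖ O l f ‖ J l g ‖ -J l h)
   ⊟ (-J l a ‖ J l b ‖ -J l c ‖ J l d ‖ O l e ‖ O l f ‖ -J l g ‖ J l h)

Amat : (k l a b c d e f g h : ℕ) →
       (X₁₁ X₂₁ : Matrix k g) (X₁₂ X₂₂ : Matrix k h) →
       (Y₁₁ Y₂₁ : Matrix l e) (Y₁₂ Y₂₂ : Matrix l f) →
       Matrix (k ℕ.+ k ℕ.+ l ℕ.+ l) (a ℕ.+ b ℕ.+ c ℕ.+ d ℕ.+ e ℕ.+ f ℕ.+ g ℕ.+ h)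
Amat k l a b c d e f g h X₁₁ X₂₁ X₁₂ X₂₂ Y₁₁ Y₂₁ Y₁₂ Y₂₂ =
      (O k a ‖ O k b ‖ J k c ‖ J k d ‖ O k e ‖ J k f ‖ X₁₁ ‖ X₁₂)
   ⊟ (J k a ‖ J k b ‖ O k c ‖ O k d ‖ J k e ‖ O k f ‖ X₂₁ ‖ X₂₂)
   ⊟ (O l a ‖ J l b ‖ O l c ‖ J l d ‖ Y₁₁ ‖ Y₁₂ ‖ O l g ‖ J l h)
   ⊟ (J l a ‖ O l b ‖ J l c ‖ O l d ‖ Y₂₁ ‖ Y₂₂ ‖ J l g ‖ O l h)

const : (n : ℕ) → ℤ → Matrix n 1
const n t _ _ = t

𝟏-𝟏 : (p q : ℕ) → Matrix (p ℕ.+ q) 1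
𝟏-𝟏 p q = 𝟏 p ⊟ -J q 1

-- "v = ((p - q)/2) 𝟏 where p - q is even": there is an integer t with p - q = 2t and v = t 𝟏
HalfDiffVec : ∀ {m} → Matrix m 1 → (p q : ℕ) → Set
HalfDiffVec {m} v p q =
  Σ ℤ (λ t → ((+ p) ℤ.- (+ q) ≡ (+ 2) ℤ.* t) × (v ≈ const m t))

module Submission where

-- Write B = A + E. Both A and B are block matrices whose blocks are constant (0 or 1), apart from
-- the X and Y blocks, so every entry of their Gram matrices is a short sum of block sizes, row or
-- column sums of the X and Y blocks, and inner products of their rows.  In the row blocks 1, 2
-- (and likewise 3, 4) B exchanges the constant blocks of A and keeps the X (resp. Y) blocks; hence
-- AᵀA = BᵀB exactly when X₁ᵢ and X₂ᵢ (resp. Y₁ᵢ and Y₂ᵢ) have equal column sums.  For AAᵀ = BBᵀ the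
-- diagonal row blocks agree because E𝟏 = 0, and the off-diagonal ones agree iff the row-sum
-- differences ξᵢ of the X part and ηⱼ of the Y part satisfy ξᵢ(x) ± ηⱼ(y) = d - a or b - c for all
-- rows x, y.  This forces ξᵢ and ηⱼ to be constant; summing ξ₁ and ξ₂ over the rows, where the
-- column-sum condition makes the totals agree, pins the constants down to (g - h)/2 and (e - f)/2.

open import Defs

-- Integer arithmetic is opened unqualified inside this module only: the statement of the
-- theorem at the end uses _+_ on ℕ.
module Proof where

  open import Data.Nat as ℕ using (ℕ; zero; suc)
  open import Data.Integer using (ℤ; +_; -[1+_]; 0ℤ; 1ℤ; _+_; _-_; _*_; -_)
  import Data.Integer.Properties as ℤ
  open import Data.Integer.Tactic.RingSolver using (solve-∀; solve)
  open import Data.List using (_∷_; [])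
  open import Data.Fin using (Fin; zero; suc; _↑ˡ_; _↑ʳ_; splitAt; join)
  open import Data.Fin.Properties using (splitAt-↑ˡ; splitAt-↑ʳ; join-splitAt)
  open import Data.Maybe using (Maybe; just; nothing; fromMaybe)
  open import Data.Unit using (⊤; tt)
  open import Data.Empty using (⊥)
  open import Data.Product using (_×_; _,_; proj₁; proj₂; Σ)
  open import Data.Sum using (_⊎_; inj₁; inj₂; [_,_])
  open import Relation.Binary.PropositionalEquality hiding (J)
  open import Relation.Nullary using (¬_)
  open import Function.Bundles using (_⇔_; mk⇔; Equivalence)
  open import Algebra.Bundles using (AbelianGroup)
  open import Algebra.Properties.Group (AbelianGroup.group ℤ.+-0-abelianGroup) using (∙-cancelˡ; ∙-cancelʳ)
  open import Algebra.Properties.CommutativeSemigroup ℤ.+-commutativeSemigroup using (interchange)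

  ∑-cong : ∀ {n} {f g : Fin n → ℤ} → (∀ i → f i ≡ g i) → ∑ f ≡ ∑ g
  ∑-cong {zero}  f≗g = refl
  ∑-cong {suc n} f≗g = cong₂ _+_ (f≗g zero) (∑-cong (λ i → f≗g (suc i)))

  ∑-const : ∀ n c → ∑ {n} (λ _ → c) ≡ + n * c
  ∑-const zero    c = sym (ℤ.*-zeroˡ c)
  ∑-const (suc n) c = trans (cong (_+_ c) (∑-const n c)) (sym (ℤ.suc-* (+ n) c))

  ∑-*ˡ : ∀ {n} c (f : Fin n → ℤ) → ∑ (λ i → c * f i) ≡ c * ∑ f
  ∑-*ˡ {zero}  c f = sym (ℤ.*-zeroʳ c)
  ∑-*ˡ {suc n} c f =
    trans (cong (_+_ (c * f zero)) (∑-*ˡ c (λ i → f (suc i)))) (sym (ℤ.*-distribˡ-+ c (f zero) _))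

  ∑-+ : ∀ {n} (f g : Fin n → ℤ) → ∑ (λ i → f i + g i) ≡ ∑ f + ∑ g
  ∑-+ {zero}  f g = refl
  ∑-+ {suc n} f g =
    trans (cong (_+_ (f zero + g zero)) (∑-+ (λ i → f (suc i)) (λ i → g (suc i))))
          (interchange (f zero) (g zero) _ _)

  ∑-neg : ∀ {n} (f : Fin n → ℤ) → ∑ (λ i → - f i) ≡ - ∑ f
  ∑-neg {zero}  f = refl
  ∑-neg {suc n} f =
    trans (cong (_+_ (- f zero)) (∑-neg (λ i → f (suc i)))) (sym (ℤ.neg-distrib-+ (f zero) _))

  ∑-- : ∀ {n} (f g : Fin n → ℤ) → ∑ (λ i → f i - g i) ≡ ∑ f - ∑ g
  ∑-- f g = trans (∑-+ f (λ i → - g i)) (cong (_+_ (∑ f)) (∑-neg g))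

  ∑-comm : ∀ {m n} (f : Fin m → Fin n → ℤ) → ∑ (λ i → ∑ (f i)) ≡ ∑ (λ j → ∑ (λ i → f i j))
  ∑-comm {zero}  {n} f = sym (trans (∑-const n 0ℤ) (ℤ.*-zeroʳ (+ n)))
  ∑-comm {suc m} f =
    trans (cong (_+_ (∑ (f zero))) (∑-comm (λ i → f (suc i)))) (sym (∑-+ (f zero) _))

  ∑-↑ : ∀ m {n} (f : Fin (m ℕ.+ n) → ℤ) → ∑ f ≡ ∑ (λ i → f (i ↑ˡ n)) + ∑ (λ j → f (m ↑ʳ j))
  ∑-↑ zero    f = sym (ℤ.+-identityˡ (∑ f))
  ∑-↑ (suc m) f =
    trans (cong (_+_ (f zero)) (∑-↑ m (λ i → f (suc i)))) (sym (ℤ.+-assoc (f zero) _ _))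

  rowSum : ∀ {m n} → Matrix m n → Fin m → ℤ
  rowSum X x = ∑ (X x)

  colSum : ∀ {m n} → Matrix m n → Fin n → ℤ
  colSum X = rowSum (X ᵀ)

  rowDot : ∀ {m m' n} → Matrix m n → Fin m → Matrix m' n → Fin m' → ℤ
  rowDot X x Y y = ∑ (λ r → X x r * Y y r)

  ∑-rowSum : ∀ {m n} (X : Matrix m n) → ∑ (rowSum X) ≡ ∑ (colSum X)
  ∑-rowSum X = ∑-comm X

  ∑-rowSum-difference : ∀ {m n n'} (X X' : Matrix m n) (Y Y' : Matrix m n') →
                        (∀ z → colSum X z ≡ colSum X' z) → (∀ z → colSum Y z ≡ colSum Y' z) →
                        ∑ (λ x → rowSum X x - rowSum Y x) ≡ ∑ (λ x → rowSum X' x - rowSum Y' x)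
  ∑-rowSum-difference {m} X X' Y Y' X~X' Y~Y' = begin
    ∑ (λ x → rowSum X x - rowSum Y x)     ≡⟨ ∑-- (rowSum X) (rowSum Y) ⟩
    ∑ (rowSum X) - ∑ (rowSum Y)           ≡⟨ cong₂ _-_ (∑-rowSum-cong X~X') (∑-rowSum-cong Y~Y') ⟩
    ∑ (rowSum X') - ∑ (rowSum Y')         ≡⟨ ∑-- (rowSum X') (rowSum Y') ⟨
    ∑ (λ x → rowSum X' x - rowSum Y' x)   ∎
    where
    open ≡-Reasoning
    ∑-rowSum-cong : ∀ {n} {X X' : Matrix m n} → (∀ z → colSum X z ≡ colSum X' z) →
                    ∑ (rowSum X) ≡ ∑ (rowSum X')
    ∑-rowSum-cong {X = X} {X'} X~X' = trans (∑-rowSum X) (trans (∑-cong X~X') (sym (∑-rowSum X')))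

  colSum-𝟏ᵀ⊗ : ∀ {m n} (X : Matrix m n) i z → ((𝟏 m ᵀ) ⊗ X) i z ≡ colSum X z
  colSum-𝟏ᵀ⊗ X i z = ∑-cong (λ r → ℤ.*-identityˡ (X r z))

  𝟏ᵀ⊗-≈⇔ : ∀ {m n} (X Y : Matrix m n) → ((𝟏 m ᵀ) ⊗ X ≈ (𝟏 m ᵀ) ⊗ Y) ⇔ (∀ z → colSum X z ≡ colSum Y z)
  𝟏ᵀ⊗-≈⇔ X Y = mk⇔
    (λ 𝟏ᵀX≈𝟏ᵀY z → trans (sym (colSum-𝟏ᵀ⊗ X zero z)) (trans (𝟏ᵀX≈𝟏ᵀY zero z) (colSum-𝟏ᵀ⊗ Y zero z)))
    (λ X~Y i z → trans (colSum-𝟏ᵀ⊗ X i z) (trans (X~Y z) (sym (colSum-𝟏ᵀ⊗ Y i z))))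

  ‖-↑ˡ : ∀ {m n₁ n₂} (M : Matrix m n₁) (N : Matrix m n₂) x j → (M ‖ N) x (j ↑ˡ n₂) ≡ M x j
  ‖-↑ˡ {n₁ = n₁} {n₂} M N x j rewrite splitAt-↑ˡ n₁ j n₂ = refl

  ‖-↑ʳ : ∀ {m n₁ n₂} (M : Matrix m n₁) (N : Matrix m n₂) x j → (M ‖ N) x (n₁ ↑ʳ j) ≡ N x j
  ‖-↑ʳ {n₁ = n₁} {n₂} M N x j rewrite splitAt-↑ʳ n₁ n₂ j = refl

  ⊟-↑ˡ : ∀ {m₁ m₂ n} (M : Matrix m₁ n) (N : Matrix m₂ n) i y → (M ⊟ N) (i ↑ˡ m₂) y ≡ M i y
  ⊟-↑ˡ {m₁} {m₂} M N i y rewrite splitAt-↑ˡ m₁ i m₂ = refl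

  ⊟-↑ʳ : ∀ {m₁ m₂ n} (M : Matrix m₁ n) (N : Matrix m₂ n) i y → (M ⊟ N) (m₁ ↑ʳ i) y ≡ N i y
  ⊟-↑ʳ {m₁} {m₂} M N i y rewrite splitAt-↑ʳ m₁ m₂ i = refl

  ↑-elim : ∀ m n (P : Fin (m ℕ.+ n) → Set) → (∀ i → P (i ↑ˡ n)) → (∀ j → P (m ↑ʳ j)) → ∀ k → P k
  ↑-elim m n P left right k =
    subst P (join-splitAt m n k) ([_,_] {C = λ u → P (join m n u)} left right (splitAt m k))

  -- Block `zero` of a partition is the last one, so that `width`, `hcat` and `vcat` nest to the
  -- left exactly like the sums of sizes and the `‖`, `⊟` in Defs.
  width : ∀ {n} → (Fin (suc n) → ℕ) → ℕ
  width {zero}  w = w zero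
  width {suc n} w = width (λ s → w (suc s)) ℕ.+ w zero

  blk : ∀ {n} (w : Fin (suc n) → ℕ) (s : Fin (suc n)) → Fin (w s) → Fin (width w)
  blk {zero}  w zero    z = z
  blk {suc n} w zero    z = width (λ s → w (suc s)) ↑ʳ z
  blk {suc n} w (suc s) z = blk (λ s → w (suc s)) s z ↑ˡ w zero

  blk-elim : ∀ {n} (w : Fin (suc n) → ℕ) (P : Fin (width w) → Set) →
             (∀ s z → P (blk w s z)) → ∀ j → P j
  blk-elim {zero}  w P H = H zero
  blk-elim {suc n} w P H =
    ↑-elim _ (w zero) P (blk-elim (λ s → w (suc s)) (λ i → P (i ↑ˡ w zero)) (λ s → H (suc s))) (H zero)

  hcat : ∀ {m n} {w : Fin (suc n) → ℕ} → ((s : Fin (suc n)) → Matrix m (w s)) → Matrix m (width w)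
  hcat {n = zero}  B = B zero
  hcat {n = suc n} B = hcat (λ s → B (suc s)) ‖ B zero

  vcat : ∀ {m n} {w : Fin (suc m) → ℕ} → ((p : Fin (suc m)) → Matrix (w p) n) → Matrix (width w) n
  vcat {m = zero}  B = B zero
  vcat {m = suc m} B = vcat (λ p → B (suc p)) ⊟ B zero

  hcat-blk : ∀ {m n} {w : Fin (suc n) → ℕ} (B : (s : Fin (suc n)) → Matrix m (w s)) x s z →
             hcat B x (blk w s z) ≡ B s x z
  hcat-blk {n = zero}  B x zero    z = refl
  hcat-blk {n = suc n} B x zero    z = ‖-↑ʳ (hcat (λ s → B (suc s))) (B zero) x z
  hcat-blk {n = suc n} B x (suc s) z =
    trans (‖-↑ˡ (hcat (λ s → B (suc s))) (B zero) x _) (hcat-blk (λ s → B (suc s)) x s z)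

  vcat-blk : ∀ {m n} {w : Fin (suc m) → ℕ} (B : (p : Fin (suc m)) → Matrix (w p) n) p x z →
             vcat B (blk w p x) z ≡ B p x z
  vcat-blk {m = zero}  B zero    x z = refl
  vcat-blk {m = suc m} B zero    x z = ⊟-↑ʳ (vcat (λ p → B (suc p))) (B zero) x z
  vcat-blk {m = suc m} B (suc p) x z =
    trans (⊟-↑ˡ (vcat (λ p → B (suc p))) (B zero) _ z) (vcat-blk (λ p → B (suc p)) p x z)

  -- `nothing` is a term known to vanish.  With `_+ᵐ_` and `_⋆_` (which treats 0, 1 and -1
  -- specially) the Gram entries of concrete block matrices evaluate, up to definitional equality,
  -- to readable sums without zero terms or unit factors.
  val : Maybe ℤ → ℤ
  val = fromMaybe 0ℤ

  infixl 6 _+ᵐ_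
  _+ᵐ_ : Maybe ℤ → Maybe ℤ → Maybe ℤ
  nothing +ᵐ v       = v
  just u  +ᵐ nothing = just u
  just u  +ᵐ just v  = just (u + v)

  +ᵐ-sound : ∀ u v → val (u +ᵐ v) ≡ val u + val v
  +ᵐ-sound nothing  v        = sym (ℤ.+-identityˡ (val v))
  +ᵐ-sound (just u) nothing  = sym (ℤ.+-identityʳ u)
  +ᵐ-sound (just u) (just v) = refl

  val-+ᵐ-assoc : ∀ u v w → val (u +ᵐ v +ᵐ w) ≡ val u + val (v +ᵐ w)
  val-+ᵐ-assoc u v w = begin
    val (u +ᵐ v +ᵐ w)         ≡⟨ +ᵐ-sound (u +ᵐ v) w ⟩
    val (u +ᵐ v) + val w      ≡⟨ cong (_+ val w) (+ᵐ-sound u v) ⟩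
    val u + val v + val w     ≡⟨ ℤ.+-assoc (val u) (val v) (val w) ⟩
    val u + (val v + val w)   ≡⟨ cong (_+_ (val u)) (+ᵐ-sound v w) ⟨
    val u + val (v +ᵐ w)      ∎
    where open ≡-Reasoning

  infixr 7 _⋆_
  _⋆_ : ℤ → Maybe ℤ → Maybe ℤ
  c        ⋆ nothing = nothing
  + 0      ⋆ just v  = nothing
  + 1      ⋆ just v  = just v
  -[1+ 0 ] ⋆ just v  = just (- v)
  c        ⋆ just v  = just (c * v)

  ⋆-sound : ∀ c u → val (c ⋆ u) ≡ c * val u
  ⋆-sound c               nothing  = sym (ℤ.*-zeroʳ c)
  ⋆-sound (+ 0)           (just v) = sym (ℤ.*-zeroˡ v)
  ⋆-sound (+ 1)           (just v) = sym (ℤ.*-identityˡ v)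
  ⋆-sound -[1+ 0 ]        (just v) = sym (ℤ.-1*i≡-i v)
  ⋆-sound (+ suc (suc n)) (just v) = refl
  ⋆-sound -[1+ suc n ]    (just v) = refl

  ∑ᵐ : ∀ {n} → (Fin (suc n) → Maybe ℤ) → Maybe ℤ
  ∑ᵐ {zero}  u = u zero
  ∑ᵐ {suc n} u = ∑ᵐ (λ s → u (suc s)) +ᵐ u zero

  ∑-blocks : ∀ {n} (w : Fin (suc n) → ℕ) (f : Fin (width w) → ℤ) (u : Fin (suc n) → Maybe ℤ) →
             (∀ s → ∑ (λ z → f (blk w s z)) ≡ val (u s)) → ∑ f ≡ val (∑ᵐ u)
  ∑-blocks {zero}  w f u H = H zero
  ∑-blocks {suc n} w f u H = begin
    ∑ f                                                      ≡⟨ ∑-↑ (width (λ s → w (suc s))) f ⟩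
    ∑ (λ i → f (i ↑ˡ w zero)) + ∑ (λ z → f (blk w zero z))  ≡⟨ cong₂ _+_ (∑-blocks _ _ _ (λ s → H (suc s)))
                                                                          (H zero) ⟩
    val (∑ᵐ (λ s → u (suc s))) + val (u zero)               ≡⟨ +ᵐ-sound (∑ᵐ (λ s → u (suc s))) (u zero) ⟨
    val (∑ᵐ u)                                               ∎
    where open ≡-Reasoning

  data Block (m n : ℕ) : Set where
    fill : ℤ → Block m n
    ⟨_⟩  : Matrix m n → Block m n

  pattern 0ᴮ  = fill (+ 0)
  pattern 1ᴮ  = fill (+ 1)
  pattern -1ᴮ = fill -[1+ 0 ]

  ⟦_⟧ : ∀ {m n} → Block m n → Matrix m n
  ⟦ fill c ⟧ _ _ = c
  ⟦ ⟨ X ⟩ ⟧      = X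

  _ᵀᴮ : ∀ {m n} → Block m n → Block n m
  fill c ᵀᴮ = fill c
  ⟨ X ⟩ ᵀᴮ  = ⟨ X ᵀ ⟩

  ᵀᴮ-sound : ∀ {m n} (β : Block m n) x z → ⟦ β ᵀᴮ ⟧ z x ≡ ⟦ β ⟧ x z
  ᵀᴮ-sound (fill c) x z = refl
  ᵀᴮ-sound ⟨ X ⟩    x z = refl

  infixl 6 _+ᴮ_
  _+ᴮ_ : ∀ {m n} → Block m n → Block m n → Block m n
  fill c +ᴮ fill c' = fill (c + c')
  ⟨ X ⟩  +ᴮ 0ᴮ      = ⟨ X ⟩
  β      +ᴮ β'      = ⟨ ⟦ β ⟧ ⊕ ⟦ β' ⟧ ⟩

  +ᴮ-sound : ∀ {m n} (β β' : Block m n) x z → ⟦ β +ᴮ β' ⟧ x z ≡ ⟦ β ⟧ x z + ⟦ β' ⟧ x z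
  +ᴮ-sound (fill c) (fill c')        x z = refl
  +ᴮ-sound ⟨ X ⟩    0ᴮ               x z = sym (ℤ.+-identityʳ (X x z))
  +ᴮ-sound ⟨ X ⟩    (fill (+ suc n)) x z = refl
  +ᴮ-sound ⟨ X ⟩    (fill -[1+ n ])  x z = refl
  +ᴮ-sound ⟨ X ⟩    ⟨ Y ⟩            x z = refl
  +ᴮ-sound (fill c) ⟨ Y ⟩            x z = refl

  BinaryBlock : ∀ {m n} → Block m n → Set
  BinaryBlock (fill c) = (c ≡ 0ℤ) ⊎ (c ≡ 1ℤ)
  BinaryBlock ⟨ X ⟩    = IsBinary X

  rowSumᴮ : ∀ {m n} → Block m n → Fin m → Maybe ℤ
  rowSumᴮ {n = n} (fill c) _ = c ⋆ just (+ n)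
  rowSumᴮ         ⟨ X ⟩    x = just (rowSum X x)

  dot : ∀ {m m' n} → Block m n → Fin m → Block m' n → Fin m' → Maybe ℤ
  dot (fill c) _ β        y = c ⋆ rowSumᴮ β y
  dot ⟨ X ⟩    x (fill c) _ = c ⋆ just (rowSum X x)
  dot ⟨ X ⟩    x ⟨ Y ⟩    y = just (rowDot X x Y y)

  rowSumᴮ-sound : ∀ {m n} (β : Block m n) x → ∑ (⟦ β ⟧ x) ≡ val (rowSumᴮ β x)
  rowSumᴮ-sound {n = n} (fill c) x =
    trans (∑-const n c) (trans (ℤ.*-comm (+ n) c) (sym (⋆-sound c (just (+ n)))))
  rowSumᴮ-sound ⟨ X ⟩ x = refl

  dot-sound : ∀ {m m' n} (β : Block m n) x (β' : Block m' n) y →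
              ∑ (λ r → ⟦ β ⟧ x r * ⟦ β' ⟧ y r) ≡ val (dot β x β' y)
  dot-sound (fill c) x β' y =
    trans (∑-*ˡ c (⟦ β' ⟧ y)) (trans (cong (_*_ c) (rowSumᴮ-sound β' y)) (sym (⋆-sound c (rowSumᴮ β' y))))
  dot-sound ⟨ X ⟩ x (fill c) y =
    trans (∑-cong (λ r → ℤ.*-comm (X x r) c)) (trans (∑-*ˡ c (X x)) (sym (⋆-sound c (just (rowSum X x)))))
  dot-sound ⟨ X ⟩ x ⟨ Y ⟩ y = refl

  Table : ∀ {P Q} → (Fin (suc P) → ℕ) → (Fin (suc Q) → ℕ) → Set
  Table ρ κ = ∀ p s → Block (ρ p) (κ s)

  build : ∀ {P Q} {ρ : Fin (suc P) → ℕ} {κ : Fin (suc Q) → ℕ} → Table ρ κ → Matrix (width ρ) (width κ)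
  build T = vcat (λ p → hcat (λ s → ⟦ T p s ⟧))

  _ᵀᵗ : ∀ {P Q} {ρ : Fin (suc P) → ℕ} {κ : Fin (suc Q) → ℕ} → Table ρ κ → Table κ ρ
  (T ᵀᵗ) s p = T p s ᵀᴮ

  dots : ∀ {P P' Q} {ρ : Fin (suc P) → ℕ} {ρ' : Fin (suc P') → ℕ} {κ : Fin (suc Q) → ℕ} →
         Table ρ κ → Table ρ' κ → ∀ p q → Fin (ρ p) → Fin (ρ' q) → Maybe ℤ
  dots T U p q x y = ∑ᵐ (λ s → dot (T p s) x (U q s) y)

  record _HasBlocks_ {P Q} {ρ : Fin (suc P) → ℕ} {κ : Fin (suc Q) → ℕ}
                     (M : Matrix (width ρ) (width κ)) (T : Table ρ κ) : Set where
    constructor blocks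
    field entry : ∀ p s x z → M (blk ρ p x) (blk κ s z) ≡ ⟦ T p s ⟧ x z

  open _HasBlocks_

  module _ {P Q : ℕ} {ρ : Fin (suc P) → ℕ} {κ : Fin (suc Q) → ℕ} where

    build-blocks : (T : Table ρ κ) → build T HasBlocks T
    build-blocks T = blocks λ p s x z →
      trans (vcat-blk (λ p → hcat (λ s → ⟦ T p s ⟧)) p x _) (hcat-blk (λ s → ⟦ T p s ⟧) x s z)

    ᵀ-blocks : ∀ {M} {T : Table ρ κ} → M HasBlocks T → (M ᵀ) HasBlocks (T ᵀᵗ)
    ᵀ-blocks {T = T} M≅T = blocks λ s p z x → trans (entry M≅T p s x z) (sym (ᵀᴮ-sound (T p s) x z))

    ⊕-blocks : ∀ {M N} {T U : Table ρ κ} → M HasBlocks T → N HasBlocks U →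
               (M ⊕ N) HasBlocks (λ p s → T p s +ᴮ U p s)
    ⊕-blocks {T = T} {U} M≅T N≅U = blocks λ p s x z →
      trans (cong₂ _+_ (entry M≅T p s x z) (entry N≅U p s x z)) (sym (+ᴮ-sound (T p s) (U p s) x z))

    blocks-≈ : ∀ {M N} {T U : Table ρ κ} → M HasBlocks T → N HasBlocks U → M ≈ N →
               ∀ p s x z → ⟦ T p s ⟧ x z ≡ ⟦ U p s ⟧ x z
    blocks-≈ M≅T N≅U M≈N p s x z = trans (sym (entry M≅T p s x z)) (trans (M≈N _ _) (entry N≅U p s x z))

    binary-blocks : ∀ {M} {T : Table ρ κ} → M HasBlocks T → (∀ p s → BinaryBlock (T p s)) → IsBinary M
    binary-blocks {M} {T} M≅T bin =
      blk-elim ρ (λ i → ∀ j → Bin (M i j)) λ p x →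
      blk-elim κ (λ j → Bin (M (blk ρ p x) j)) λ s z →
      subst Bin (sym (entry M≅T p s x z)) (binary-entry (T p s) (bin p s) x z)
      where
      Bin : ℤ → Set
      Bin v = (v ≡ 0ℤ) ⊎ (v ≡ 1ℤ)
      binary-entry : ∀ {m n} (β : Block m n) → BinaryBlock β → ∀ x z → Bin (⟦ β ⟧ x z)
      binary-entry (fill c) c∈01 x z = c∈01
      binary-entry ⟨ X ⟩    X∈01     = X∈01

  ⊗ᵀ-blocks : ∀ {P P' Q} {ρ : Fin (suc P) → ℕ} {ρ' : Fin (suc P') → ℕ} {κ : Fin (suc Q) → ℕ}
              {M N} {T : Table ρ κ} {U : Table ρ' κ} → M HasBlocks T → N HasBlocks U →
              ∀ p q x y → (M ⊗ (N ᵀ)) (blk ρ p x) (blk ρ' q y) ≡ val (dots T U p q x y)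
  ⊗ᵀ-blocks {κ = κ} {T = T} {U} M≅T N≅U p q x y =
    ∑-blocks κ _ _ λ s →
      trans (∑-cong λ z → cong₂ _*_ (entry M≅T p s x z) (entry N≅U q s y z)) (dot-sound (T p s) x (U q s) y)

  gram-≈⇔ : ∀ {P Q} {ρ : Fin (suc P) → ℕ} {κ : Fin (suc Q) → ℕ} {M N} {T U : Table ρ κ} →
            M HasBlocks T → N HasBlocks U →
            (M ⊗ (M ᵀ) ≈ N ⊗ (N ᵀ)) ⇔ (∀ p q x y → val (dots T T p q x y) ≡ val (dots U U p q x y))
  gram-≈⇔ {ρ = ρ} {M = M} {N} M≅T N≅U = mk⇔
    (λ gram p q x y →
      trans (sym (⊗ᵀ-blocks M≅T M≅T p q x y)) (trans (gram _ _) (⊗ᵀ-blocks N≅U N≅U p q x y)))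
    (λ dots≡ →
      blk-elim ρ (λ i → ∀ j → (M ⊗ (M ᵀ)) i j ≡ (N ⊗ (N ᵀ)) i j) λ p x →
      blk-elim ρ (λ j → (M ⊗ (M ᵀ)) (blk ρ p x) j ≡ (N ⊗ (N ᵀ)) (blk ρ p x) j) λ q y →
      trans (⊗ᵀ-blocks M≅T M≅T p q x y) (trans (dots≡ p q x y) (sym (⊗ᵀ-blocks N≅U N≅U p q x y))))

  module _ {m n₁ n₂ : ℕ} (X₁₁ X₂₁ : Matrix m n₁) (X₁₂ X₂₂ : Matrix m n₂) where

    private
      halves : Fin 2 → ℕ
      halves _ = m

      sides : Fin 2 → ℕ
      sides (suc zero) = n₁
      sides zero       = n₂

      quadrants : Table halves sides
      quadrants (suc zero) (suc zero) = ⟨ X₁₁ ⟩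
      quadrants (suc zero) zero       = ⟨ X₁₂ ⟩
      quadrants zero       (suc zero) = ⟨ X₂₁ ⟩
      quadrants zero       zero       = ⟨ X₂₂ ⟩

      signs : Table {Q = 0} sides (λ _ → 1)
      signs (suc zero) _ = 1ᴮ
      signs zero       _ = -1ᴮ

      ⊗𝟏-𝟏-blocks : ∀ p x j → ((X₁₁ ‖ X₁₂ ⊟ X₂₁ ‖ X₂₂) ⊗ 𝟏-𝟏 n₁ n₂) (blk halves p x) j ≡
                              val (dots quadrants (signs ᵀᵗ) p zero x j)
      ⊗𝟏-𝟏-blocks p x j = ⊗ᵀ-blocks (build-blocks quadrants) (ᵀ-blocks (build-blocks signs)) p zero x j

    halfDiffVec⇔ : HalfDiffVec ((X₁₁ ‖ X₁₂ ⊟ X₂₁ ‖ X₂₂) ⊗ 𝟏-𝟏 n₁ n₂) n₁ n₂ ⇔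
                   Σ ℤ λ t → (+ n₁ - + n₂ ≡ + 2 * t) × (∀ x → rowSum X₁₁ x - rowSum X₁₂ x ≡ t)
                                                    × (∀ x → rowSum X₂₁ x - rowSum X₂₂ x ≡ t)
    halfDiffVec⇔ = mk⇔
      (λ (t , n₁-n₂≡2t , v≈t) →
        t , n₁-n₂≡2t , (λ x → trans (sym (⊗𝟏-𝟏-blocks (suc zero) x zero)) (v≈t _ zero))
                     , (λ x → trans (sym (⊗𝟏-𝟏-blocks zero x zero)) (v≈t _ zero)))
      (λ (t , n₁-n₂≡2t , ξ₁≡t , ξ₂≡t) →
        t , n₁-n₂≡2t , blk-elim halves (λ i → ∀ j → _ ≡ t) λ where
          (suc zero) x j → trans (⊗𝟏-𝟏-blocks (suc zero) x j) (ξ₁≡t x)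
          zero       x j → trans (⊗𝟏-𝟏-blocks zero x j) (ξ₂≡t x))

  -- In one column block, the blocks (α₁, α₂) of two row blocks of A become (β₁, β₂) in B:
  -- constant 0/1 blocks are exchanged, matrix blocks are kept.
  data Exchange {m n} : Block m n → Block m n → Block m n → Block m n → Set where
    swap₀₁ : Exchange 0ᴮ 1ᴮ 1ᴮ 0ᴮ
    swap₁₀ : Exchange 1ᴮ 0ᴮ 0ᴮ 1ᴮ
    keep   : (X Y : Matrix m n) → Exchange ⟨ X ⟩ ⟨ Y ⟩ ⟨ X ⟩ ⟨ Y ⟩

  module _ {m n : ℕ} where

    OnKept : (Matrix m n → Matrix m n → Set) → ∀ {α₁ α₂ β₁ β₂} → Exchange α₁ α₂ β₁ β₂ → Set
    OnKept P swap₀₁     = ⊤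
    OnKept P swap₁₀     = ⊤
    OnKept P (keep X Y) = P X Y

    IsSwap : ∀ {α₁ α₂ β₁ β₂} → Exchange α₁ α₂ β₁ β₂ → Set
    IsSwap = OnKept (λ _ _ → ⊥)

    ColumnBalanced : ∀ {α₁ α₂ β₁ β₂} → Exchange α₁ α₂ β₁ β₂ → Set
    ColumnBalanced = OnKept (λ X Y → ∀ z → colSum X z ≡ colSum Y z)

    swap-onKept : ∀ {P α₁ α₂ β₁ β₂} (v : Exchange α₁ α₂ β₁ β₂) → IsSwap v → OnKept P v
    swap-onKept swap₀₁ _ = tt
    swap-onKept swap₁₀ _ = tt

    swap-differs : ∀ {α₁ α₂ β₁ β₂} (v : Exchange α₁ α₂ β₁ β₂) → IsSwap v → ∀ x z → ⟦ α₁ ⟧ x z ≢ ⟦ β₁ ⟧ x z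
    swap-differs swap₀₁ _ x z ()
    swap-differs swap₁₀ _ x z ()

    exchange-binary : ∀ {α₁ α₂ β₁ β₂} (v : Exchange α₁ α₂ β₁ β₂) →
                      OnKept (λ X Y → IsBinary X × IsBinary Y) v →
                      (BinaryBlock α₁ × BinaryBlock α₂) × (BinaryBlock β₁ × BinaryBlock β₂)
    exchange-binary swap₀₁     _             = (inj₁ refl , inj₂ refl) , (inj₂ refl , inj₁ refl)
    exchange-binary swap₁₀     _             = (inj₂ refl , inj₁ refl) , (inj₁ refl , inj₂ refl)
    exchange-binary (keep X Y) (X∈01 , Y∈01) = (X∈01 , Y∈01) , (X∈01 , Y∈01)

  columnPair : ∀ {m n n'} → Block m n → Block m n → Fin n → Block m n' → Block m n' → Fin n' → Maybe ℤ
  columnPair α₁ α₂ z α₁' α₂' w = dot (α₁ ᵀᴮ) z (α₁' ᵀᴮ) w +ᵐ dot (α₂ ᵀᴮ) z (α₂' ᵀᴮ) w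

  module _ {m n n' : ℕ} {α₁ α₂ β₁ β₂ : Block m n} {α₁' α₂' β₁' β₂' : Block m n'} where

    exchange-columnPair : (v : Exchange α₁ α₂ β₁ β₂) (v' : Exchange α₁' α₂' β₁' β₂') →
                          ColumnBalanced v → ColumnBalanced v' →
                          ∀ z w → columnPair α₁ α₂ z α₁' α₂' w ≡ columnPair β₁ β₂ z β₁' β₂' w
    exchange-columnPair swap₀₁     swap₀₁      _   _   z w = refl
    exchange-columnPair swap₀₁     swap₁₀      _   _   z w = refl
    exchange-columnPair swap₁₀     swap₀₁      _   _   z w = refl
    exchange-columnPair swap₁₀     swap₁₀      _   _   z w = refl
    exchange-columnPair swap₀₁     (keep X Y)  _   X~Y z w = cong just (sym (X~Y w))
    exchange-columnPair swap₁₀     (keep X Y)  _   X~Y z w = cong just (X~Y w)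
    exchange-columnPair (keep X Y) swap₀₁      X~Y _   z w = cong just (sym (X~Y z))
    exchange-columnPair (keep X Y) swap₁₀      X~Y _   z w = cong just (X~Y z)
    exchange-columnPair (keep X Y) (keep X' Y') _  _   z w = refl

    swap-columnPair-balanced : (v : Exchange α₁ α₂ β₁ β₂) → IsSwap v → (v' : Exchange α₁' α₂' β₁' β₂') → ∀ z →
                               (∀ w → val (columnPair α₁ α₂ z α₁' α₂' w) ≡
                                      val (columnPair β₁ β₂ z β₁' β₂' w)) →
                               ColumnBalanced v'
    swap-columnPair-balanced swap₀₁ _ swap₀₁     z eq = tt
    swap-columnPair-balanced swap₀₁ _ swap₁₀     z eq = tt
    swap-columnPair-balanced swap₀₁ _ (keep X Y) z eq = λ w → sym (eq w)
    swap-columnPair-balanced swap₁₀ _ swap₀₁     z eq = tt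
    swap-columnPair-balanced swap₁₀ _ swap₁₀     z eq = tt
    swap-columnPair-balanced swap₁₀ _ (keep X Y) z eq = eq

  x+y≡z⇒y≡z-x : ∀ {x y z} → x + y ≡ z → y ≡ z - x
  x+y≡z⇒y≡z-x {x} {y} refl = solve (x ∷ y ∷ [])

  x-y≡z⇒x≡z+y : ∀ {x y z} → x - y ≡ z → x ≡ z + y
  x-y≡z⇒x≡z+y {x} {y} refl = solve (x ∷ y ∷ [])

  x-y≡z⇒y≡x-z : ∀ {x y z} → x - y ≡ z → y ≡ x - z
  x-y≡z⇒y≡x-z {x} {y} refl = solve (x ∷ y ∷ [])

  ≡⇔≡-by-difference : ∀ {x y u v : ℤ} → x - y ≡ u - v → (x ≡ y ⇔ u ≡ v)
  ≡⇔≡-by-difference {x} {y} {u} {v} eq = mk⇔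
    (λ x≡y → ℤ.i-j≡0⇒i≡j u v (trans (sym eq) (ℤ.i≡j⇒i-j≡0 x≡y)))
    (λ u≡v → ℤ.i-j≡0⇒i≡j x y (trans eq (ℤ.i≡j⇒i-j≡0 u≡v)))

  rearrange₊ : ∀ u₁ u₂ u₃ v₁ v₂ v₃ → (u₁ + u₂ + u₃ ≡ v₁ + v₂ + v₃) ⇔ ((u₃ - v₃) + (u₂ - v₂) ≡ v₁ - u₁)
  rearrange₊ u₁ u₂ u₃ v₁ v₂ v₃ = ≡⇔≡-by-difference (identity u₁ u₂ u₃ v₁ v₂ v₃)
    where
    identity : ∀ u₁ u₂ u₃ v₁ v₂ v₃ → u₁ + u₂ + u₃ - (v₁ + v₂ + v₃) ≡ (u₃ - v₃) + (u₂ - v₂) - (v₁ - u₁)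
    identity = solve-∀

  rearrange₋ : ∀ u₁ u₂ u₃ v₁ v₂ v₃ → (u₁ + u₂ + u₃ ≡ v₁ + v₂ + v₃) ⇔ ((u₃ - v₃) - (v₂ - u₂) ≡ v₁ - u₁)
  rearrange₋ u₁ u₂ u₃ v₁ v₂ v₃ = ≡⇔≡-by-difference (identity u₁ u₂ u₃ v₁ v₂ v₃)
    where
    identity : ∀ u₁ u₂ u₃ v₁ v₂ v₃ → u₁ + u₂ + u₃ - (v₁ + v₂ + v₃) ≡ (u₃ - v₃) - (v₂ - u₂) - (v₁ - u₁)
    identity = solve-∀

  insert-shared : ∀ u₁ u₂ u₃ v₁ v₂ v₃ w₁ w₂ → u₁ + u₂ + u₃ ≡ v₁ + v₂ + v₃ →
                  u₁ + u₂ + w₁ + w₂ + u₃ ≡ v₁ + v₂ + w₁ + w₂ + v₃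
  insert-shared u₁ u₂ u₃ v₁ v₂ v₃ w₁ w₂ =
    Equivalence.to (≡⇔≡-by-difference (identity u₁ u₂ u₃ v₁ v₂ v₃ w₁ w₂))
    where
    identity : ∀ u₁ u₂ u₃ v₁ v₂ v₃ w₁ w₂ →
               u₁ + u₂ + u₃ - (v₁ + v₂ + v₃) ≡ u₁ + u₂ + w₁ + w₂ + u₃ - (v₁ + v₂ + w₁ + w₂ + v₃)
    identity = solve-∀

  halves⇒sum-and-difference : ∀ {α β T U} → + 2 * T ≡ α + β → + 2 * U ≡ α - β → (T + U ≡ α) × (T - U ≡ β)
  halves⇒sum-and-difference {α} {β} {T} {U} 2T≡α+β 2U≡α-β =
    ℤ.*-cancelˡ-≡ (+ 2) (T + U) α (begin
      + 2 * (T + U)       ≡⟨ ℤ.*-distribˡ-+ (+ 2) T U ⟩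
      + 2 * T + + 2 * U   ≡⟨ cong₂ _+_ 2T≡α+β 2U≡α-β ⟩
      α + β + (α - β)     ≡⟨ sum α β ⟩
      + 2 * α             ∎) ,
    ℤ.*-cancelˡ-≡ (+ 2) (T - U) β (begin
      + 2 * (T - U)       ≡⟨ distrib T U ⟩
      + 2 * T - + 2 * U   ≡⟨ cong₂ _-_ 2T≡α+β 2U≡α-β ⟩
      α + β - (α - β)     ≡⟨ difference α β ⟩
      + 2 * β             ∎)
    where
    open ≡-Reasoning
    distrib : ∀ T U → + 2 * (T - U) ≡ + 2 * T - + 2 * U
    distrib = solve-∀
    sum : ∀ α β → α + β + (α - β) ≡ + 2 * α
    sum = solve-∀
    difference : ∀ α β → α + β - (α - β) ≡ + 2 * β
    difference = solve-∀

  sum⇒halves : ∀ {α β T} → T + T ≡ α + β → (+ 2 * T ≡ α + β) × (+ 2 * (α - T) ≡ α - β)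
  sum⇒halves {α} {β} {T} T+T≡α+β =
    trans (double T) T+T≡α+β , sym (Equivalence.from (≡⇔≡-by-difference (identity T α β)) T+T≡α+β)
    where
    double : ∀ T → + 2 * T ≡ T + T
    double = solve-∀
    identity : ∀ T α β → α - β - + 2 * (α - T) ≡ T + T - (α + β)
    identity = solve-∀

  module Balance {m n : ℕ} (α β : ℤ) (ξ₁ ξ₂ : Fin m → ℤ) (η₁ η₂ : Fin n → ℤ) where

    Balanced : Set
    Balanced = ∀ x y → (ξ₁ x + η₁ y ≡ α) × (ξ₁ x - η₂ y ≡ β) × (ξ₂ x - η₁ y ≡ β) × (ξ₂ x + η₂ y ≡ α)

    Constant : Set
    Constant = Σ ℤ λ T → (T + T ≡ α + β) × (∀ x → ξ₁ x ≡ T) × (∀ x → ξ₂ x ≡ T)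
                       × (∀ y → η₁ y ≡ α - T) × (∀ y → η₂ y ≡ α - T)

    constant⇒balanced : ∀ T U → T + U ≡ α → T - U ≡ β → (∀ x → ξ₁ x ≡ T) → (∀ x → ξ₂ x ≡ T) →
                        (∀ y → η₁ y ≡ U) → (∀ y → η₂ y ≡ U) → Balanced
    constant⇒balanced T U T+U≡α T-U≡β ξ₁≡T ξ₂≡T η₁≡U η₂≡U x y
      rewrite ξ₁≡T x | ξ₂≡T x | η₁≡U y | η₂≡U y = T+U≡α , T-U≡β , T-U≡β , T+U≡α

    balanced⇒constant : .{{_ : ℕ.NonZero m}} → Fin m → Fin n → ∑ ξ₁ ≡ ∑ ξ₂ → Balanced → Constant
    balanced⇒constant x₀ y₀ ∑ξ₁≡∑ξ₂ bal = T , T+T≡α+β , ξ₁≡T , ξ₂≡T , η₁≡α-T , η₂≡α-T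
      where
      T : ℤ
      T = ξ₁ x₀

      η₁≡α-T : ∀ y → η₁ y ≡ α - T
      η₁≡α-T y = x+y≡z⇒y≡z-x (proj₁ (bal x₀ y))

      ξ₁≡T : ∀ x → ξ₁ x ≡ T
      ξ₁≡T x = ∙-cancelʳ (η₁ y₀) (ξ₁ x) T (trans (proj₁ (bal x y₀)) (sym (proj₁ (bal x₀ y₀))))

      ξ₂≡β+α-T : ∀ x → ξ₂ x ≡ β + (α - T)
      ξ₂≡β+α-T x = trans (x-y≡z⇒x≡z+y (proj₁ (proj₂ (proj₂ (bal x y₀))))) (cong (_+_ β) (η₁≡α-T y₀))

      T≡β+α-T : T ≡ β + (α - T)
      T≡β+α-T = ℤ.*-cancelˡ-≡ (+ m) T (β + (α - T)) (begin
        + m * T                    ≡⟨ ∑-const m T ⟨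
        ∑ {m} (λ _ → T)            ≡⟨ ∑-cong ξ₁≡T ⟨
        ∑ ξ₁                       ≡⟨ ∑ξ₁≡∑ξ₂ ⟩
        ∑ ξ₂                       ≡⟨ ∑-cong ξ₂≡β+α-T ⟩
        ∑ {m} (λ _ → β + (α - T))  ≡⟨ ∑-const m (β + (α - T)) ⟩
        + m * (β + (α - T))        ∎)
        where open ≡-Reasoning

      T+T≡α+β : T + T ≡ α + β
      T+T≡α+β = Equivalence.to (≡⇔≡-by-difference (identity T α β)) T≡β+α-T
        where
        identity : ∀ T α β → T - (β + (α - T)) ≡ T + T - (α + β)
        identity = solve-∀

      ξ₂≡T : ∀ x → ξ₂ x ≡ T
      ξ₂≡T x = trans (ξ₂≡β+α-T x) (sym T≡β+α-T)

      η₂≡α-T : ∀ y → η₂ y ≡ α - T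
      η₂≡α-T y = trans (x-y≡z⇒y≡x-z {T} (proj₁ (proj₂ (bal x₀ y))))
                       (Equivalence.to (≡⇔≡-by-difference (identity T α β)) T≡β+α-T)
        where
        identity : ∀ T α β → T - (β + (α - T)) ≡ T - β - (α - T)
        identity = solve-∀

  module Setting (k l a b c d e f g h : ℕ)
                 (X₁₁ X₂₁ : Matrix k g) (X₁₂ X₂₂ : Matrix k h)
                 (Y₁₁ Y₂₁ : Matrix l e) (Y₁₂ Y₂₂ : Matrix l f) where

    pattern r₁ = suc (suc (suc zero))
    pattern r₂ = suc (suc zero)
    pattern r₃ = suc zero
    pattern r₄ = zero

    pattern ca = suc (suc (suc (suc (suc (suc (suc zero))))))
    pattern cb = suc (suc (suc (suc (suc (suc zero)))))
    pattern cc = suc (suc (suc (suc (suc zero))))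
    pattern cd = suc (suc (suc (suc zero)))
    pattern ce = suc (suc (suc zero))
    pattern cf = suc (suc zero)
    pattern cg = suc zero
    pattern ch = zero

    heights : Fin 4 → ℕ
    heights r₁ = k
    heights r₂ = k
    heights r₃ = l
    heights r₄ = l

    widths : Fin 8 → ℕ
    widths ca = a
    widths cb = b
    widths cc = c
    widths cd = d
    widths ce = e
    widths cf = f
    widths cg = g
    widths ch = h

    row : ∀ {m} → Block m a → Block m b → Block m c → Block m d →
          Block m e → Block m f → Block m g → Block m h → ∀ s → Block m (widths s)
    row βa βb βc βd βe βf βg βh ca = βa
    row βa βb βc βd βe βf βg βh cb = βb
    row βa βb βc βd βe βf βg βh cc = βc
    row βa βb βc βd βe βf βg βh cd = βd
    row βa βb βc βd βe βf βg βh ce = βe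
    row βa βb βc βd βe βf βg βh cf = βf
    row βa βb βc βd βe βf βg βh cg = βg
    row βa βb βc βd βe βf βg βh ch = βh

    A-table : Table heights widths
    A-table r₁ = row 0ᴮ 0ᴮ 1ᴮ 1ᴮ 0ᴮ 1ᴮ ⟨ X₁₁ ⟩ ⟨ X₁₂ ⟩
    A-table r₂ = row 1ᴮ 1ᴮ 0ᴮ 0ᴮ 1ᴮ 0ᴮ ⟨ X₂₁ ⟩ ⟨ X₂₂ ⟩
    A-table r₃ = row 0ᴮ 1ᴮ 0ᴮ 1ᴮ ⟨ Y₁₁ ⟩ ⟨ Y₁₂ ⟩ 0ᴮ 1ᴮ
    A-table r₄ = row 1ᴮ 0ᴮ 1ᴮ 0ᴮ ⟨ Y₂₁ ⟩ ⟨ Y₂₂ ⟩ 1ᴮ 0ᴮ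

    E-table : Table heights widths
    E-table r₁ = row 1ᴮ  1ᴮ  -1ᴮ -1ᴮ 1ᴮ  -1ᴮ 0ᴮ  0ᴮ
    E-table r₂ = row -1ᴮ -1ᴮ 1ᴮ  1ᴮ  -1ᴮ 1ᴮ  0ᴮ  0ᴮ
    E-table r₃ = row 1ᴮ  -1ᴮ 1ᴮ  -1ᴮ 0ᴮ  0ᴮ  1ᴮ  -1ᴮ
    E-table r₄ = row -1ᴮ 1ᴮ  -1ᴮ 1ᴮ  0ᴮ  0ᴮ  -1ᴮ 1ᴮ

    B-table : Table heights widths
    B-table p s = A-table p s +ᴮ E-table p s

    E : Matrix (width heights) (width widths)
    E = Emat k l a b c d e f g h

    A B : Matrix (width heights) (width widths)
    A = Amat k l a b c d e f g h X₁₁ X₂₁ X₁₂ X₂₂ Y₁₁ Y₂₁ Y₁₂ Y₂₂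
    B = A ⊕ E

    A-blocks : A HasBlocks A-table
    A-blocks = build-blocks A-table

    E-blocks : E HasBlocks E-table
    E-blocks = build-blocks E-table

    B-blocks : B HasBlocks B-table
    B-blocks = ⊕-blocks A-blocks E-blocks

    upper : ∀ s → Exchange (A-table r₁ s) (A-table r₂ s) (B-table r₁ s) (B-table r₂ s)
    upper ca = swap₀₁
    upper cb = swap₀₁
    upper cc = swap₁₀
    upper cd = swap₁₀
    upper ce = swap₀₁
    upper cf = swap₁₀
    upper cg = keep X₁₁ X₂₁
    upper ch = keep X₁₂ X₂₂

    lower : ∀ s → Exchange (A-table r₃ s) (A-table r₄ s) (B-table r₃ s) (B-table r₄ s)
    lower ca = swap₀₁
    lower cb = swap₁₀
    lower cc = swap₀₁
    lower cd = swap₁₀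
    lower ce = keep Y₁₁ Y₂₁
    lower cf = keep Y₁₂ Y₂₂
    lower cg = swap₀₁
    lower ch = swap₁₀

    upper-onKept : (P : ∀ {n} → Matrix k n → Matrix k n → Set) → P X₁₁ X₂₁ → P X₁₂ X₂₂ →
                   ∀ s → OnKept P (upper s)
    upper-onKept P P₁ P₂ ca = tt
    upper-onKept P P₁ P₂ cb = tt
    upper-onKept P P₁ P₂ cc = tt
    upper-onKept P P₁ P₂ cd = tt
    upper-onKept P P₁ P₂ ce = tt
    upper-onKept P P₁ P₂ cf = tt
    upper-onKept P P₁ P₂ cg = P₁
    upper-onKept P P₁ P₂ ch = P₂

    lower-onKept : (P : ∀ {n} → Matrix l n → Matrix l n → Set) → P Y₁₁ Y₂₁ → P Y₁₂ Y₂₂ →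
                   ∀ s → OnKept P (lower s)
    lower-onKept P P₁ P₂ ca = tt
    lower-onKept P P₁ P₂ cb = tt
    lower-onKept P P₁ P₂ cc = tt
    lower-onKept P P₁ P₂ cd = tt
    lower-onKept P P₁ P₂ ce = P₁
    lower-onKept P P₁ P₂ cf = P₂
    lower-onKept P P₁ P₂ cg = tt
    lower-onKept P P₁ P₂ ch = tt

    SharedColumn : Set
    SharedColumn = Σ (Fin 8) λ s → Fin (widths s) × IsSwap (upper s) × IsSwap (lower s)

    shared-column : Fin (a ℕ.+ b ℕ.+ c ℕ.+ d) → SharedColumn
    shared-column = blk-elim abcd (λ _ → SharedColumn) column
      where
      abcd : Fin 4 → ℕ
      abcd s = widths (suc (suc (suc (suc s))))
      column : ∀ s → Fin (abcd s) → SharedColumn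
      column r₁ z = ca , z , tt , tt
      column r₂ z = cb , z , tt , tt
      column r₃ z = cc , z , tt , tt
      column r₄ z = cd , z , tt , tt

    A≉B : Fin k → SharedColumn → ¬ (A ≈ B)
    A≉B x (s , z , swapped , _) A≈B =
      swap-differs (upper s) swapped x z (blocks-≈ A-blocks B-blocks A≈B r₁ s x z)

    module _ (X₁₁∈01 : IsBinary X₁₁) (X₁₂∈01 : IsBinary X₁₂) (X₂₁∈01 : IsBinary X₂₁) (X₂₂∈01 : IsBinary X₂₂)
             (Y₁₁∈01 : IsBinary Y₁₁) (Y₁₂∈01 : IsBinary Y₁₂) (Y₂₁∈01 : IsBinary Y₂₁) (Y₂₂∈01 : IsBinary Y₂₂) where

      private
        Binary₂ : ∀ {m n} → Matrix m n → Matrix m n → Set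
        Binary₂ X Y = IsBinary X × IsBinary Y

        upper-binary : ∀ s → (BinaryBlock (A-table r₁ s) × BinaryBlock (A-table r₂ s))
                           × (BinaryBlock (B-table r₁ s) × BinaryBlock (B-table r₂ s))
        upper-binary s = exchange-binary (upper s) (upper-onKept Binary₂ (X₁₁∈01 , X₂₁∈01) (X₁₂∈01 , X₂₂∈01) s)

        lower-binary : ∀ s → (BinaryBlock (A-table r₃ s) × BinaryBlock (A-table r₄ s))
                           × (BinaryBlock (B-table r₃ s) × BinaryBlock (B-table r₄ s))
        lower-binary s = exchange-binary (lower s) (lower-onKept Binary₂ (Y₁₁∈01 , Y₂₁∈01) (Y₁₂∈01 , Y₂₂∈01) s)

      A-binary : IsBinary A
      A-binary = binary-blocks A-blocks λ where
        r₁ s → proj₁ (proj₁ (upper-binary s))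
        r₂ s → proj₂ (proj₁ (upper-binary s))
        r₃ s → proj₁ (proj₁ (lower-binary s))
        r₄ s → proj₂ (proj₁ (lower-binary s))

      B-binary : IsBinary B
      B-binary = binary-blocks B-blocks λ where
        r₁ s → proj₁ (proj₂ (upper-binary s))
        r₂ s → proj₂ (proj₂ (upper-binary s))
        r₃ s → proj₁ (proj₂ (lower-binary s))
        r₄ s → proj₂ (proj₂ (lower-binary s))

    ColumnSums : Set
    ColumnSums = ((𝟏 k ᵀ) ⊗ X₁₁ ≈ (𝟏 k ᵀ) ⊗ X₂₁) × ((𝟏 k ᵀ) ⊗ X₁₂ ≈ (𝟏 k ᵀ) ⊗ X₂₂)
               × ((𝟏 l ᵀ) ⊗ Y₁₁ ≈ (𝟏 l ᵀ) ⊗ Y₂₁) × ((𝟏 l ᵀ) ⊗ Y₁₂ ≈ (𝟏 l ᵀ) ⊗ Y₂₂)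

    upperPair lowerPair : Table heights widths → ∀ s s' → Fin (widths s) → Fin (widths s') → Maybe ℤ
    upperPair T s s' z w = columnPair (T r₁ s) (T r₂ s) z (T r₁ s') (T r₂ s') w
    lowerPair T s s' z w = columnPair (T r₃ s) (T r₄ s) z (T r₃ s') (T r₄ s') w

    column-dots : ∀ T s s' z w →
                  val (dots (T ᵀᵗ) (T ᵀᵗ) s s' z w) ≡ val (upperPair T s s' z w) + val (lowerPair T s s' z w)
    column-dots T s s' z w = val-+ᵐ-assoc (upperPair T s s' z w) _ _

    ColumnDotsEqual : Set
    ColumnDotsEqual =
      ∀ s s' z w → val (dots (A-table ᵀᵗ) (A-table ᵀᵗ) s s' z w) ≡ val (dots (B-table ᵀᵗ) (B-table ᵀᵗ) s s' z w)

    column-dots-halves : ColumnDotsEqual → ∀ s s' z w →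
                         val (upperPair A-table s s' z w) + val (lowerPair A-table s s' z w) ≡
                         val (upperPair B-table s s' z w) + val (lowerPair B-table s s' z w)
    column-dots-halves dots≡ s s' z w =
      trans (sym (column-dots A-table s s' z w)) (trans (dots≡ s s' z w) (column-dots B-table s s' z w))

    balanced⇒column-dots : (∀ s → ColumnBalanced (upper s)) → (∀ s → ColumnBalanced (lower s)) →
                           ColumnDotsEqual
    balanced⇒column-dots upper-balanced lower-balanced s s' z w =
      trans (column-dots A-table s s' z w) (trans (cong₂ _+_ (cong val upper≡) (cong val lower≡))
                                                  (sym (column-dots B-table s s' z w)))
      where
      upper≡ : upperPair A-table s s' z w ≡ upperPair B-table s s' z w
      upper≡ = exchange-columnPair (upper s) (upper s') (upper-balanced s) (upper-balanced s') z w
      lower≡ : lowerPair A-table s s' z w ≡ lowerPair B-table s s' z w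
      lower≡ = exchange-columnPair (lower s) (lower s') (lower-balanced s) (lower-balanced s') z w

    column-dots⇒upper-balanced : ColumnDotsEqual → SharedColumn →
                                 ∀ s' → IsSwap (lower s') → ColumnBalanced (upper s')
    column-dots⇒upper-balanced dots≡ (s , z , up , low) s' low' =
      swap-columnPair-balanced (upper s) up (upper s') z λ w →
        ∙-cancelʳ (val (lowerPair A-table s s' z w)) _ _
          (trans (column-dots-halves dots≡ s s' z w)
                 (cong (_+_ (val (upperPair B-table s s' z w))) (cong val (sym (lower≡ w)))))
      where
      lower≡ : ∀ w → lowerPair A-table s s' z w ≡ lowerPair B-table s s' z w
      lower≡ = exchange-columnPair (lower s) (lower s') (swap-onKept (lower s) low)
                                   (swap-onKept (lower s') low') z

    column-dots⇒lower-balanced : ColumnDotsEqual → SharedColumn →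
                                 ∀ s' → IsSwap (upper s') → ColumnBalanced (lower s')
    column-dots⇒lower-balanced dots≡ (s , z , up , low) s' up' =
      swap-columnPair-balanced (lower s) low (lower s') z λ w →
        ∙-cancelˡ (val (upperPair A-table s s' z w)) _ _
          (trans (column-dots-halves dots≡ s s' z w)
                 (cong (_+ val (lowerPair B-table s s' z w)) (cong val (sym (upper≡ w)))))
      where
      upper≡ : ∀ w → upperPair A-table s s' z w ≡ upperPair B-table s s' z w
      upper≡ = exchange-columnPair (upper s) (upper s') (swap-onKept (upper s) up)
                                   (swap-onKept (upper s') up') z

    column-gram⇒sums : SharedColumn → (A ᵀ) ⊗ A ≈ (B ᵀ) ⊗ B → ColumnSums
    column-gram⇒sums shared columns =
        Equivalence.from (𝟏ᵀ⊗-≈⇔ X₁₁ X₂₁) (column-dots⇒upper-balanced dots≡ shared cg tt)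
      , Equivalence.from (𝟏ᵀ⊗-≈⇔ X₁₂ X₂₂) (column-dots⇒upper-balanced dots≡ shared ch tt)
      , Equivalence.from (𝟏ᵀ⊗-≈⇔ Y₁₁ Y₂₁) (column-dots⇒lower-balanced dots≡ shared ce tt)
      , Equivalence.from (𝟏ᵀ⊗-≈⇔ Y₁₂ Y₂₂) (column-dots⇒lower-balanced dots≡ shared cf tt)
      where
      dots≡ : ColumnDotsEqual
      dots≡ = Equivalence.to (gram-≈⇔ (ᵀ-blocks A-blocks) (ᵀ-blocks B-blocks)) columns

    sums⇒column-gram : ColumnSums → (A ᵀ) ⊗ A ≈ (B ᵀ) ⊗ B
    sums⇒column-gram (X₁ , X₂ , Y₁ , Y₂) =
      Equivalence.from (gram-≈⇔ (ᵀ-blocks A-blocks) (ᵀ-blocks B-blocks)) (balanced⇒column-dots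
        (upper-onKept SameColSums (Equivalence.to (𝟏ᵀ⊗-≈⇔ X₁₁ X₂₁) X₁) (Equivalence.to (𝟏ᵀ⊗-≈⇔ X₁₂ X₂₂) X₂))
        (lower-onKept SameColSums (Equivalence.to (𝟏ᵀ⊗-≈⇔ Y₁₁ Y₂₁) Y₁) (Equivalence.to (𝟏ᵀ⊗-≈⇔ Y₁₂ Y₂₂) Y₂)))
      where
      SameColSums : ∀ {m n} → Matrix m n → Matrix m n → Set
      SameColSums X Y = ∀ z → colSum X z ≡ colSum Y z

    ξ₁ ξ₂ : Fin k → ℤ
    ξ₁ x = rowSum X₁₁ x - rowSum X₁₂ x
    ξ₂ x = rowSum X₂₁ x - rowSum X₂₂ x

    η₁ η₂ : Fin l → ℤ
    η₁ y = rowSum Y₁₁ y - rowSum Y₁₂ y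
    η₂ y = rowSum Y₂₁ y - rowSum Y₂₂ y

    α β : ℤ
    α = + d - + a
    β = + b - + c

    open Balance α β ξ₁ ξ₂ η₁ η₂

    Sizes₁ Sizes₃ : Set
    Sizes₁ = + a + + b + + e ≡ + c + + d + + f
    Sizes₃ = + a + + c + + g ≡ + b + + d + + h

    ones : Table {P = 0} (λ _ → 1) widths
    ones _ _ = 1ᴮ

    ones-blocks : J 1 (width widths) HasBlocks ones
    ones-blocks = blocks λ _ _ _ _ → refl

    E-row-sums : E ⊗ 𝟏 (width widths) ≈ O (width heights) 1 →
                 ∀ p x → val (dots E-table ones p zero x zero) ≡ 0ℤ
    E-row-sums E𝟏≈0 p x = trans (sym (⊗ᵀ-blocks E-blocks ones-blocks p zero x zero)) (E𝟏≈0 _ zero)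

    row-sums⇒sizes₁ : E ⊗ 𝟏 (width widths) ≈ O (width heights) 1 → Fin k → Sizes₁
    row-sums⇒sizes₁ E𝟏≈0 x =
      Equivalence.to (≡⇔≡-by-difference (identity (+ a) (+ b) (+ c) (+ d) (+ e) (+ f))) (E-row-sums E𝟏≈0 r₁ x)
      where
      identity : ∀ a b c d e f → a + b + - c + - d + e + - f - 0ℤ ≡ a + b + e - (c + d + f)
      identity = solve-∀

    row-sums⇒sizes₃ : E ⊗ 𝟏 (width widths) ≈ O (width heights) 1 → Fin l → Sizes₃
    row-sums⇒sizes₃ E𝟏≈0 y =
      Equivalence.to (≡⇔≡-by-difference (identity (+ a) (+ b) (+ c) (+ d) (+ g) (+ h))) (E-row-sums E𝟏≈0 r₃ y)
      where
      identity : ∀ a b c d g h → a + - b + c + - d + g + - h - 0ℤ ≡ a + c + g - (b + d + h)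
      identity = solve-∀

    sizes₁⇒e-f : Sizes₁ → + e - + f ≡ α - β
    sizes₁⇒e-f = Equivalence.to (≡⇔≡-by-difference (identity (+ a) (+ b) (+ c) (+ d) (+ e) (+ f)))
      where
      identity : ∀ a b c d e f → a + b + e - (c + d + f) ≡ e - f - ((d - a) - (b - c))
      identity = solve-∀

    sizes₃⇒g-h : Sizes₃ → + g - + h ≡ α + β
    sizes₃⇒g-h = Equivalence.to (≡⇔≡-by-difference (identity (+ a) (+ b) (+ c) (+ d) (+ g) (+ h)))
      where
      identity : ∀ a b c d g h → a + c + g - (b + d + h) ≡ g - h - ((d - a) + (b - c))
      identity = solve-∀

    RowDotsEqual : Set
    RowDotsEqual = ∀ p q x y → val (dots A-table A-table p q x y) ≡ val (dots B-table B-table p q x y)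

    gram₁₃ : ∀ x y → (+ a + rowSum Y₁₁ y + rowSum X₁₁ x ≡ + d + rowSum Y₁₂ y + rowSum X₁₂ x) ⇔ (ξ₁ x + η₁ y ≡ α)
    gram₁₃ x y = rearrange₊ (+ a) (rowSum Y₁₁ y) (rowSum X₁₁ x) (+ d) (rowSum Y₁₂ y) (rowSum X₁₂ x)

    gram₁₄ : ∀ x y → (+ c + rowSum Y₂₂ y + rowSum X₁₁ x ≡ + b + rowSum Y₂₁ y + rowSum X₁₂ x) ⇔ (ξ₁ x - η₂ y ≡ β)
    gram₁₄ x y = rearrange₋ (+ c) (rowSum Y₂₂ y) (rowSum X₁₁ x) (+ b) (rowSum Y₂₁ y) (rowSum X₁₂ x)

    gram₂₃ : ∀ x y → (+ c + rowSum Y₁₂ y + rowSum X₂₁ x ≡ + b + rowSum Y₁₁ y + rowSum X₂₂ x) ⇔ (ξ₂ x - η₁ y ≡ β)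
    gram₂₃ x y = rearrange₋ (+ c) (rowSum Y₁₂ y) (rowSum X₂₁ x) (+ b) (rowSum Y₁₁ y) (rowSum X₂₂ x)

    gram₂₄ : ∀ x y → (+ a + rowSum Y₂₁ y + rowSum X₂₁ x ≡ + d + rowSum Y₂₂ y + rowSum X₂₂ x) ⇔ (ξ₂ x + η₂ y ≡ α)
    gram₂₄ x y = rearrange₊ (+ a) (rowSum Y₂₁ y) (rowSum X₂₁ x) (+ d) (rowSum Y₂₂ y) (rowSum X₂₂ x)

    row-dots⇒balanced : RowDotsEqual → Balanced
    row-dots⇒balanced dots≡ x y =
        Equivalence.to (gram₁₃ x y) (sym (dots≡ r₁ r₃ x y))
      , Equivalence.to (gram₁₄ x y) (dots≡ r₁ r₄ x y)
      , Equivalence.to (gram₂₃ x y) (sym (dots≡ r₂ r₃ x y))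
      , Equivalence.to (gram₂₄ x y) (dots≡ r₂ r₄ x y)

    balanced⇒row-dots : Sizes₁ → Sizes₃ → Balanced → RowDotsEqual
    balanced⇒row-dots sizes₁ sizes₃ bal = dots≡
      where
      dots≡ : RowDotsEqual
      dots≡ r₁ r₁ x y = cong (λ t → t + rowDot X₁₁ x X₁₁ y + rowDot X₁₂ x X₁₂ y) (sym sizes₁)
      dots≡ r₁ r₂ x y = refl
      dots≡ r₁ r₃ x y = sym (Equivalence.from (gram₁₃ x y) (proj₁ (bal x y)))
      dots≡ r₁ r₄ x y = Equivalence.from (gram₁₄ x y) (proj₁ (proj₂ (bal x y)))
      dots≡ r₂ r₁ x y = refl
      dots≡ r₂ r₂ x y = cong (λ t → t + rowDot X₂₁ x X₂₁ y + rowDot X₂₂ x X₂₂ y) sizes₁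
      dots≡ r₂ r₃ x y = sym (Equivalence.from (gram₂₃ x y) (proj₁ (proj₂ (proj₂ (bal x y)))))
      dots≡ r₂ r₄ x y = Equivalence.from (gram₂₄ x y) (proj₂ (proj₂ (proj₂ (bal x y))))
      dots≡ r₃ r₁ x y = sym (Equivalence.from (gram₁₃ y x) (proj₁ (bal y x)))
      dots≡ r₃ r₂ x y = sym (Equivalence.from (gram₂₃ y x) (proj₁ (proj₂ (proj₂ (bal y x)))))
      dots≡ r₃ r₃ x y =
        insert-shared (+ b) (+ d) (+ h) (+ a) (+ c) (+ g) (rowDot Y₁₁ x Y₁₁ y) (rowDot Y₁₂ x Y₁₂ y) (sym sizes₃)
      dots≡ r₃ r₄ x y = refl
      dots≡ r₄ r₁ x y = Equivalence.from (gram₁₄ y x) (proj₁ (proj₂ (bal y x)))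
      dots≡ r₄ r₂ x y = Equivalence.from (gram₂₄ y x) (proj₂ (proj₂ (proj₂ (bal y x))))
      dots≡ r₄ r₃ x y = refl
      dots≡ r₄ r₄ x y =
        insert-shared (+ a) (+ c) (+ g) (+ b) (+ d) (+ h) (rowDot Y₂₁ x Y₂₁ y) (rowDot Y₂₂ x Y₂₂ y) sizes₃

    HalfDiffs : Set
    HalfDiffs = HalfDiffVec ((X₁₁ ‖ X₁₂ ⊟ X₂₁ ‖ X₂₂) ⊗ 𝟏-𝟏 g h) g h
              × HalfDiffVec ((Y₁₁ ‖ Y₁₂ ⊟ Y₂₁ ‖ Y₂₂) ⊗ 𝟏-𝟏 e f) e f

    constant⇒halfDiffs : Sizes₁ → Sizes₃ → Constant → HalfDiffs
    constant⇒halfDiffs sizes₁ sizes₃ (T , T+T≡α+β , ξ₁≡T , ξ₂≡T , η₁≡α-T , η₂≡α-T) =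
        Equivalence.from (halfDiffVec⇔ X₁₁ X₂₁ X₁₂ X₂₂)
          (T , trans (sizes₃⇒g-h sizes₃) (sym 2T≡α+β) , ξ₁≡T , ξ₂≡T)
      , Equivalence.from (halfDiffVec⇔ Y₁₁ Y₂₁ Y₁₂ Y₂₂)
          (α - T , trans (sizes₁⇒e-f sizes₁) (sym 2U≡α-β) , η₁≡α-T , η₂≡α-T)
      where
      2T≡α+β : + 2 * T ≡ α + β
      2T≡α+β = proj₁ (sum⇒halves {α} {β} T+T≡α+β)
      2U≡α-β : + 2 * (α - T) ≡ α - β
      2U≡α-β = proj₂ (sum⇒halves {α} {β} T+T≡α+β)

    halfDiffs⇒balanced : Sizes₁ → Sizes₃ → HalfDiffs → Balanced
    halfDiffs⇒balanced sizes₁ sizes₃ (X-half , Y-half) =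
      let (T , g-h≡2T , ξ₁≡T , ξ₂≡T) = Equivalence.to (halfDiffVec⇔ X₁₁ X₂₁ X₁₂ X₂₂) X-half
          (U , e-f≡2U , η₁≡U , η₂≡U) = Equivalence.to (halfDiffVec⇔ Y₁₁ Y₂₁ Y₁₂ Y₂₂) Y-half
          (T+U≡α , T-U≡β) = halves⇒sum-and-difference (trans (sym g-h≡2T) (sizes₃⇒g-h sizes₃))
                                                      (trans (sym e-f≡2U) (sizes₁⇒e-f sizes₁))
      in constant⇒balanced T U T+U≡α T-U≡β ξ₁≡T ξ₂≡T η₁≡U η₂≡U

    row-gram⇒halfDiffs : .{{_ : ℕ.NonZero k}} → Fin k → Fin l → Sizes₁ → Sizes₃ →
                         ColumnSums → A ⊗ (A ᵀ) ≈ B ⊗ (B ᵀ) → HalfDiffs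
    row-gram⇒halfDiffs x₀ y₀ sizes₁ sizes₃ (X₁ , X₂ , _ , _) rows =
      constant⇒halfDiffs sizes₁ sizes₃ (balanced⇒constant x₀ y₀ ∑ξ₁≡∑ξ₂ balanced)
      where
      ∑ξ₁≡∑ξ₂ : ∑ ξ₁ ≡ ∑ ξ₂
      ∑ξ₁≡∑ξ₂ = ∑-rowSum-difference X₁₁ X₂₁ X₁₂ X₂₂ (Equivalence.to (𝟏ᵀ⊗-≈⇔ X₁₁ X₂₁) X₁)
                                                    (Equivalence.to (𝟏ᵀ⊗-≈⇔ X₁₂ X₂₂) X₂)
      balanced : Balanced
      balanced = row-dots⇒balanced (Equivalence.to (gram-≈⇔ A-blocks B-blocks) rows)

    halfDiffs⇒row-gram : Sizes₁ → Sizes₃ → HalfDiffs → A ⊗ (A ᵀ) ≈ B ⊗ (B ᵀ)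
    halfDiffs⇒row-gram sizes₁ sizes₃ halfDiffs =
      Equivalence.from (gram-≈⇔ A-blocks B-blocks)
        (balanced⇒row-dots sizes₁ sizes₃ (halfDiffs⇒balanced sizes₁ sizes₃ halfDiffs))

open import Data.Nat using (ℕ; _+_; _<_; >-nonZero)
open import Data.Product using (_×_; _,_)
open import Data.Fin using (Fin; fromℕ<)
open import Function.Bundles using (_⇔_; mk⇔)
open Proof

theorem4p15 :
    (k l a b c d e f g h : ℕ) →
    0 < k → 0 < l → 0 < a + b + c + d → 0 < e + f → 0 < g + h →
    Emat k l a b c d e f g h ⊗ 𝟏 (a + b + c + d + e + f + g + h) ≈ O (k + k + l + l) 1 →
    (𝟏 (k + k + l + l) ᵀ) ⊗ Emat k l a b c d e f g h ≈ O 1 (a + b + c + d + e + f + g + h) →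
    (X₁₁ X₂₁ : Matrix k g) (X₁₂ X₂₂ : Matrix k h) →
    (Y₁₁ Y₂₁ : Matrix l e) (Y₁₂ Y₂₂ : Matrix l f) →
    IsBinary X₁₁ → IsBinary X₁₂ → IsBinary X₂₁ → IsBinary X₂₂ →
    IsBinary Y₁₁ → IsBinary Y₁₂ → IsBinary Y₂₁ → IsBinary Y₂₂ →
    GramMates (Amat k l a b c d e f g h X₁₁ X₂₁ X₁₂ X₂₂ Y₁₁ Y₂₁ Y₁₂ Y₂₂)
              (Amat k l a b c d e f g h X₁₁ X₂₁ X₁₂ X₂₂ Y₁₁ Y₂₁ Y₁₂ Y₂₂ ⊕ Emat k l a b c d e f g h)
    ⇔
    ( ( ((𝟏 k ᵀ) ⊗ X₁₁ ≈ (𝟏 k ᵀ) ⊗ X₂₁) × ((𝟏 k ᵀ) ⊗ X₁₂ ≈ (𝟏 k ᵀ) ⊗ X₂₂)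
      × ((𝟏 l ᵀ) ⊗ Y₁₁ ≈ (𝟏 l ᵀ) ⊗ Y₂₁) × ((𝟏 l ᵀ) ⊗ Y₁₂ ≈ (𝟏 l ᵀ) ⊗ Y₂₂) )
    × ( HalfDiffVec ((X₁₁ ‖ X₁₂ ⊟ X₂₁ ‖ X₂₂) ⊗ 𝟏-𝟏 g h) g h
      × HalfDiffVec ((Y₁₁ ‖ Y₁₂ ⊟ Y₂₁ ‖ Y₂₂) ⊗ 𝟏-𝟏 e f) e f ) )
theorem4p15 k l a b c d e f g h 0<k 0<l 0<a+b+c+d _ _ E𝟏≈0 _ X₁₁ X₂₁ X₁₂ X₂₂ Y₁₁ Y₂₁ Y₁₂ Y₂₂
            X₁₁∈01 X₁₂∈01 X₂₁∈01 X₂₂∈01 Y₁₁∈01 Y₁₂∈01 Y₂₁∈01 Y₂₂∈01 = mk⇔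
  (λ (_ , _ , rows , columns , _) →
    let sums = column-gram⇒sums shared columns
    in sums , row-gram⇒halfDiffs {{>-nonZero 0<k}} x₀ y₀ sizes₁ sizes₃ sums rows)
  (λ (sums , halfDiffs) →
      A-binary X₁₁∈01 X₁₂∈01 X₂₁∈01 X₂₂∈01 Y₁₁∈01 Y₁₂∈01 Y₂₁∈01 Y₂₂∈01
    , B-binary X₁₁∈01 X₁₂∈01 X₂₁∈01 X₂₂∈01 Y₁₁∈01 Y₁₂∈01 Y₂₁∈01 Y₂₂∈01
    , halfDiffs⇒row-gram sizes₁ sizes₃ halfDiffs
    , sums⇒column-gram sums
    , A≉B x₀ shared)
  where
  open Setting k l a b c d e f g h X₁₁ X₂₁ X₁₂ X₂₂ Y₁₁ Y₂₁ Y₁₂ Y₂₂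
  x₀ : Fin k
  x₀ = fromℕ< 0<k
  y₀ : Fin l
  y₀ = fromℕ< 0<l
  shared : SharedColumn
  shared = shared-column (fromℕ< 0<a+b+c+d)
  sizes₁ : Sizes₁
  sizes₁ = row-sums⇒sizes₁ E𝟏≈0 x₀
  sizes₃ : Sizes₃
  sizes₃ = row-sums⇒sizes₃ E𝟏≈0 y₀
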